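{- The approximation ratio of $\textsc{Greedy+Singleton}$ for MSK is no greater than $\beta=0.42945$. That is, there exists an MSK instance $(E,f,w,W)$ and an execution of $\textsc{Greedy+Singleton}$ on it (with ties in $\textsc{Greedy}$ broken arbitrarily) whose output $S$ satisfies $f(S)<0.42945\cdot\max\{f(T): T\subseteq E,\ w(T)\leq W\}$.
   Context: An MSK instance is a tuple $(E,f,w,W)$ where $E$ is a finite set of elements, $f:2^E\to\mathbb{R}_{\geq 0}$ is a non-negative, monotone and submodular set function given by a value oracle, $w:E\to\mathbb{N}_{+}$ is a weight function, and $W\in\mathbb{N}$ is the capacity; for $S\subseteq E$, $w(S)=\sum_{e\in S}w(e)$, and $S$ is feasible if $w(S)\leq W$; the goal is a feasible $S$ maximizing $f(S)$. For $A\subseteq E$, $f_A(S)=f(A\cup S)-f(A)$. The procedure $\textsc{Greedy}(E,f,w,W)$ is: set $E'\leftarrow E$, $A\leftarrow\emptyset$; while $E'\neq\emptyset$: find $e\in E'$ maximizing $f_A(\{e\})/w(e)$ (ties broken arbitrarily), set $E'\leftarrow E'\setminus\{e\}$, and if $w(A\cup\{e\})\leq W$ set $A\leftarrow A\cup\{e\}$; return $A$. The algorithm $\textsc{Greedy+Singleton}$ on $(E,f,w,W)$: compute $A\leftarrow\textsc{Greedy}(E,f,w,W)$; let $e=\arg\max_{e\in E: w(e)\leq W} f(\{e\})$; if $f(A)\geq f(\{e\})$ return $A$, otherwise return $\{e\}$. The approximation ratio of an algorithm is the infimum, over all instances and all executions of the algorithm on them, of the ratio between the value of the output and the optimal value.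 -}

module Defs where

open import Data.Nat as ℕ using (ℕ; zero; suc)
open import Data.Bool using (Bool; true; false; if_then_else_)
open import Data.Fin using (Fin)
open import Data.Fin.Subset using (Subset; _∈_; _⊆_; _∪_; _∩_; ⁅_⁆; Empty) renaming (_-_ to _∖_)
open import Data.Vec using (Vec; lookup; tabulate; foldr)
open import Data.Integer using (+_)
open import Data.Rational using (ℚ; 0ℚ; _/_; _÷_; _≤_; _<_; _-_; _+_; _*_)
open import Data.Product using (Σ; _×_)
open import Relation.Nullary using (Dec; yes; no)
import Relation.Binary.PropositionalEquality
import Data.Fin.Subset

weight : ∀ {n} → (Fin n → ℕ) → Subset n → ℕ
weight {n} w S = foldr _ ℕ._+_ 0 (tabulate (λ i → if lookup S i then w i else 0))

Feasible : ∀ {n} → (Fin n → ℕ) → ℕ → Subset n → Set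
Feasible w W S = weight w S ℕ.≤ W

SetFn : ℕ → Set
SetFn n = Subset n → ℚ

NonNegative : ∀ {n} → SetFn n → Set
NonNegative f = ∀ S → 0ℚ ≤ f S

Monotone : ∀ {n} → SetFn n → Set
Monotone f = ∀ S T → S ⊆ T → f S ≤ f T

Submodular : ∀ {n} → SetFn n → Set
Submodular f = ∀ S T → f (S ∪ T) + f (S ∩ T) ≤ f S + f T

marginal : ∀ {n} → SetFn n → Subset n → Subset n → ℚ
marginal f A S = f (A ∪ S) - f A

-- q / k for a positive natural k (k = 0 never arises since weights are positive)
divℕ : ℚ → ℕ → ℚ
divℕ q zero    = 0ℚ
divℕ q (suc k) = q * (+ 1 / suc k)

density : ∀ {n} → SetFn n → (Fin n → ℕ) → Subset n → Fin n → ℚ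
density f w A e = divℕ (marginal f A ⁅ e ⁆) (w e)

addIfFits : ∀ {n} → (Fin n → ℕ) → ℕ → Subset n → Fin n → Subset n
addIfFits w W A e with weight w (A ∪ ⁅ e ⁆) ℕ.≤? W
... | yes _ = A ∪ ⁅ e ⁆
... | no  _ = A

-- GreedyRun f w W E' A out : starting from remaining set E' and current
-- solution A, some execution of the Greedy loop (arbitrary tie-breaking)
-- terminates with output out.
data GreedyRun {n} (f : SetFn n) (w : Fin n → ℕ) (W : ℕ)
     : Subset n → Subset n → Subset n → Set where
  done : ∀ {E' A} → Empty E' → GreedyRun f w W E' A A
  step : ∀ {E' A out} (e : Fin n) → e ∈ E'
       → (∀ e' → e' ∈ E' → density f w A e' ≤ density f w A e)
       → GreedyRun f w W (E' ∖ e) (addIfFits w W A e) out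
       → GreedyRun f w W E' A out

Greedy : ∀ {n} → SetFn n → (Fin n → ℕ) → ℕ → Subset n → Set
Greedy {n} f w W A = GreedyRun f w W (Data.Fin.Subset.⊤) Data.Fin.Subset.⊥ A

data GreedySingleton {n} (f : SetFn n) (w : Fin n → ℕ) (W : ℕ) : Subset n → Set where
  run : (A : Subset n) (e : Fin n) → Greedy f w W A
      → w e ℕ.≤ W
      → (∀ e' → w e' ℕ.≤ W → f ⁅ e' ⁆ ≤ f ⁅ e ⁆)
      → (S : Subset n)
      → ((f ⁅ e ⁆ ≤ f A → S Relation.Binary.PropositionalEquality.≡ A)
         × (f A < f ⁅ e ⁆ → S Relation.Binary.PropositionalEquality.≡ ⁅ e ⁆))
      → GreedySingleton f w W S

Optimal : ∀ {n} → SetFn n → (Fin n → ℕ) → ℕ → Subset n → Set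
Optimal f w W T = Feasible w W T × (∀ T' → Feasible w W T' → f T' ≤ f T)

β : ℚ
β = + 42945 / 100000

module Submission where

-- The function is a weighted coverage function on three items of values a, a and c, in which every
-- element covers every item independently with some probability; such functions are monotone and
-- submodular. KA small elements cover item 3 with probability 1 - r, KB medium elements cover each
-- item with probability 1 - t, one single element covers item 3, and two big elements of weight wb
-- cover items 1 and 2. The weights and r, t are tuned so that Greedy may take the small elements,
-- then the medium ones, then the single element, each time with maximal (tied) density; they weigh
-- wb + 1 + wS in total, so afterwards neither big element fits. Greedy thus ends with value
-- 2a(1 - t^KB) + c, the best singleton is a big element of value a, and the optimum {single, big₁,
-- big₂} has value 2a + c. For KA = 2254 and KB = 5618 the quotient is below 0.42945.

open import Algebra.Bundles using (CommutativeRing)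
open import Data.Bool using (if_then_else_)
open import Data.Empty using (⊥-elim)
open import Data.Fin using (Fin; zero; suc; toℕ; fromℕ<)
import Data.Fin.Properties as Finₚ
open import Data.Fin.Subset
  using (Subset; inside; outside; _∈_; _∉_; _⊆_; _∪_; _∩_; ⁅_⁆; ⊥; ⊤; Empty)
  renaming (_-_ to _∖_)
open import Data.Fin.Subset.Properties
  using (drop-∷-⊆; ∪-identityʳ; ∪-identityˡ; p⊆p∪q; q⊆p∪q; p─⊥≡p; ∉⊥; ⊥⊆; ∈⊤; Empty-unique)
open import Data.Integer as ℤ using (+_)
import Data.Integer.Properties as ℤₚ
open import Data.Nat as ℕ using (ℕ; zero; suc; z≤n; s≤s; NonZero)
import Data.Nat.Coprimality as Coprimality
import Data.Nat.Properties as ℕₚ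
open import Data.Nat.Tactic.RingSolver using () renaming (solve-∀ to ℕ-solve-∀)
open import Data.Product using (Σ; _×_; _,_; proj₁; proj₂)
open import Data.Rational
  using (ℚ; 0ℚ; 1ℚ; _+_; _*_; _-_; -_; _≤_; _<_; _/_; 1/_; nonNegative; Positive)
open import Data.Rational.Literals using (fromℤ)
open import Data.Rational.Properties
import Data.Rational.Unnormalised as ℚᵘ
import Data.Rational.Unnormalised.Properties as ℚᵘₚ
open import Data.Sum using (_⊎_; inj₁; inj₂)
open import Data.Vec using ([]; _∷_; here; there)
open import Function using (_∘_; it)
open import Relation.Binary.Definitions using (tri<; tri≈; tri>)
open import Relation.Binary.PropositionalEquality
open import Relation.Nullary using (yes; no)
open import Relation.Nullary.Decidable using (True; does; dec-true; dec-false; dec⇒maybe; toWitness)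
open import Relation.Nullary.Negation using (contradiction)
open import Tactic.RingSolver using (solve-∀)
open import Tactic.RingSolver.Core.AlmostCommutativeRing using (AlmostCommutativeRing; fromCommutativeRing)

open import Algebra.Properties.CommutativeSemiring.Exp
  (CommutativeRing.commutativeSemiring +-*-commutativeRing) using (_^_; ^-distrib-*)

open import Defs

ℚ-ring : AlmostCommutativeRing _ _
ℚ-ring = fromCommutativeRing +-*-commutativeRing (λ x → dec⇒maybe (0ℚ ≟ x))

0≤1 : 0ℚ ≤ 1ℚ
0≤1 = nonNegative⁻¹ 1ℚ

*-nonNeg : ∀ {p q} → 0ℚ ≤ p → 0ℚ ≤ q → 0ℚ ≤ p * q
*-nonNeg {p} {q} 0≤p 0≤q =
  nonNegative⁻¹ (p * q) {{nonNeg*nonNeg⇒nonNeg p {{nonNegative 0≤p}} q {{nonNegative 0≤q}}}}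

*-mono-≤-nonNeg : ∀ {p q r s} → 0ℚ ≤ p → 0ℚ ≤ r → p ≤ q → r ≤ s → p * r ≤ q * s
*-mono-≤-nonNeg {p} {q} {r} {s} 0≤p 0≤r p≤q r≤s = ≤-trans
  (*-monoʳ-≤-nonNeg r {{nonNegative 0≤r}} p≤q)
  (*-monoˡ-≤-nonNeg q {{nonNegative (≤-trans 0≤p p≤q)}} r≤s)

_∈[0,1] : ℚ → Set
p ∈[0,1] = 0ℚ ≤ p × p ≤ 1ℚ

≤⇒0≤- : ∀ {p q} → p ≤ q → 0ℚ ≤ q - p
≤⇒0≤- {p} {q} p≤q = subst (_≤ q - p) (+-inverseʳ p) (+-monoˡ-≤ (- p) p≤q)

≤-by-gap : ∀ {p q d} → 0ℚ ≤ d → p + d ≡ q → p ≤ q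
≤-by-gap {p} {q} {d} 0≤d p+d≡q =
  subst₂ _≤_ (+-identityʳ p) p+d≡q (+-monoʳ-≤ p 0≤d)

-- The step behind the supermodularity of products: when u ≤ x, scaling both by q ∈ [0,1]
-- helps the right-hand side.
+-≤-scaleˡ : ∀ {q u v x y} → q ∈[0,1] → u ≤ x → x + y ≤ u + v → q * x + y ≤ q * u + v
+-≤-scaleˡ {q} {u} {v} {x} {y} (_ , q≤1) u≤x x+y≤u+v =
  ≤-by-gap (+-mono-≤ (≤⇒0≤- x+y≤u+v) (*-nonNeg (≤⇒0≤- q≤1) (≤⇒0≤- u≤x))) (gap q u v x y)
  where
  gap : ∀ q u v x y → q * x + y + ((u + v - (x + y)) + (1ℚ - q) * (x - u)) ≡ q * u + v
  gap = solve-∀ ℚ-ring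

≤-by-scaling : ∀ {p q p′ q′} s .{{_ : Positive s}} → p * s ≡ p′ → q * s ≡ q′ → p′ ≤ q′ → p ≤ q
≤-by-scaling s ps≡p′ qs≡q′ p′≤q′ = *-cancelʳ-≤-pos s (subst₂ _≤_ (sym ps≡p′) (sym qs≡q′) p′≤q′)

<-by-scaling : ∀ {p q p′ q′} s .{{_ : Positive s}} → p * s ≡ p′ → q * s ≡ q′ → p′ < q′ → p < q
<-by-scaling s ps≡p′ qs≡q′ p′<q′ =
  *-cancelʳ-<-nonNeg s {{pos⇒nonNeg s}} (subst₂ _<_ (sym ps≡p′) (sym qs≡q′) p′<q′)

⌜_⌝ : ℕ → ℚ
⌜ m ⌝ = fromℤ (+ m)

⌜⌝-positive : ∀ m .{{_ : NonZero m}} → Positive ⌜ m ⌝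
⌜⌝-positive (suc m) = _

⌜⌝-nonNeg : ∀ m → 0ℚ ≤ ⌜ m ⌝
⌜⌝-nonNeg m = nonNegative⁻¹ ⌜ m ⌝

⌜⌝-+ : ∀ m n → ⌜ m ℕ.+ n ⌝ ≡ ⌜ m ⌝ + ⌜ n ⌝
⌜⌝-+ m n = toℚᵘ-injective (ℚᵘₚ.≃-trans (ℚᵘ.*≡* eq) (ℚᵘₚ.≃-sym (toℚᵘ-homo-+ ⌜ m ⌝ ⌜ n ⌝)))
  where
  eq : + (m ℕ.+ n) ℤ.* + 1 ≡ (+ m ℤ.* + 1 ℤ.+ + n ℤ.* + 1) ℤ.* + 1
  eq = cong (ℤ._* + 1) (trans (ℤₚ.pos-+ m n) (sym (cong₂ ℤ._+_ (ℤₚ.*-identityʳ (+ m)) (ℤₚ.*-identityʳ (+ n)))))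

⌜⌝-* : ∀ m n → ⌜ m ℕ.* n ⌝ ≡ ⌜ m ⌝ * ⌜ n ⌝
⌜⌝-* m n = toℚᵘ-injective (ℚᵘₚ.≃-trans (ℚᵘ.*≡* eq) (ℚᵘₚ.≃-sym (toℚᵘ-homo-* ⌜ m ⌝ ⌜ n ⌝)))
  where
  eq : + (m ℕ.* n) ℤ.* + 1 ≡ (+ m ℤ.* + n) ℤ.* + 1
  eq = cong (ℤ._* + 1) (ℤₚ.pos-* m n)

⌜⌝-^ : ∀ m k → ⌜ m ℕ.^ k ⌝ ≡ ⌜ m ⌝ ^ k
⌜⌝-^ m zero    = refl
⌜⌝-^ m (suc k) = trans (⌜⌝-* m (m ℕ.^ k)) (cong (⌜ m ⌝ *_) (⌜⌝-^ m k))

^-scale : ∀ {x s u} k → x * ⌜ s ⌝ ≡ ⌜ u ⌝ → x ^ k * ⌜ s ℕ.^ k ⌝ ≡ ⌜ u ℕ.^ k ⌝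
^-scale {x} {s} {u} k xs≡u = begin
  x ^ k * ⌜ s ℕ.^ k ⌝ ≡⟨ cong (x ^ k *_) (⌜⌝-^ s k) ⟩
  x ^ k * ⌜ s ⌝ ^ k   ≡⟨ ^-distrib-* x ⌜ s ⌝ k ⟨
  (x * ⌜ s ⌝) ^ k     ≡⟨ cong (_^ k) xs≡u ⟩
  ⌜ u ⌝ ^ k           ≡⟨ ⌜⌝-^ u k ⟨
  ⌜ u ℕ.^ k ⌝         ∎
  where open ≡-Reasoning

divℕ-* : ∀ p m .{{_ : NonZero m}} → divℕ (p * ⌜ m ⌝) m ≡ p
divℕ-* p (suc m) = begin
  p * ⌜ suc m ⌝ * (+ 1 / suc m)     ≡⟨ cong (p * ⌜ suc m ⌝ *_) (normalize-coprime (Coprimality.1-coprimeTo (suc m))) ⟩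
  p * ⌜ suc m ⌝ * 1/ ⌜ suc m ⌝      ≡⟨ *-assoc p ⌜ suc m ⌝ (1/ ⌜ suc m ⌝) ⟩
  p * (⌜ suc m ⌝ * 1/ ⌜ suc m ⌝)    ≡⟨ cong (p *_) (*-inverseʳ ⌜ suc m ⌝) ⟩
  p * 1ℚ                            ≡⟨ *-identityʳ p ⟩
  p                                 ∎
  where open ≡-Reasoning

divℕ-mono-≤ : ∀ {p q} m → p ≤ q → divℕ p m ≤ divℕ q m
divℕ-mono-≤ zero    _   = ≤-refl
divℕ-mono-≤ (suc m) p≤q = *-monoʳ-≤-nonNeg (+ 1 / suc m) {{normalize-nonNeg 1 (suc m)}} p≤q

^-nonNeg : ∀ {p} k → 0ℚ ≤ p → 0ℚ ≤ p ^ k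
^-nonNeg zero    _   = 0≤1
^-nonNeg (suc k) 0≤p = *-nonNeg 0≤p (^-nonNeg k 0≤p)

^-antitone : ∀ {p k l} → p ∈[0,1] → k ℕ.≤ l → p ^ l ≤ p ^ k
^-antitone {p} {k} {zero}  _             z≤n = ≤-refl
^-antitone {p} {k} {suc l} p∈@(0≤p , p≤1) k≤1+l with ℕₚ.m≤n⇒m<n∨m≡n k≤1+l
... | inj₂ refl     = ≤-refl
... | inj₁ (s≤s k≤l) = begin
  p * p ^ l  ≤⟨ *-monoʳ-≤-nonNeg (p ^ l) {{nonNegative (^-nonNeg l 0≤p)}} p≤1 ⟩
  1ℚ * p ^ l ≡⟨ *-identityˡ (p ^ l) ⟩
  p ^ l      ≤⟨ ^-antitone p∈ k≤l ⟩
  p ^ k      ∎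
  where open ≤-Reasoning

1^k≡1 : ∀ k → 1ℚ ^ k ≡ 1ℚ
1^k≡1 zero    = refl
1^k≡1 (suc k) = trans (*-identityˡ (1ℚ ^ k)) (1^k≡1 k)

∏ : ∀ {n} → (Fin n → ℚ) → Subset n → ℚ
∏ q []            = 1ℚ
∏ q (inside  ∷ S) = q zero * ∏ (q ∘ suc) S
∏ q (outside ∷ S) = ∏ (q ∘ suc) S

∏-⊥ : ∀ {n} (q : Fin n → ℚ) → ∏ q ⊥ ≡ 1ℚ
∏-⊥ {zero}  q = refl
∏-⊥ {suc n} q = ∏-⊥ (q ∘ suc)

∏-⁅⁆ : ∀ {n} (q : Fin n → ℚ) i → ∏ q ⁅ i ⁆ ≡ q i
∏-⁅⁆ q zero    = trans (cong (q zero *_) (∏-⊥ (q ∘ suc))) (*-identityʳ (q zero))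
∏-⁅⁆ q (suc i) = ∏-⁅⁆ (q ∘ suc) i

∏-∪⁅⁆ : ∀ {n} (q : Fin n → ℚ) S {i} → i ∉ S → ∏ q (S ∪ ⁅ i ⁆) ≡ ∏ q S * q i
∏-∪⁅⁆ q (inside  ∷ S) {zero}  i∉S = contradiction here i∉S
∏-∪⁅⁆ q (outside ∷ S) {zero}  _   =
  trans (cong (λ T → q zero * ∏ (q ∘ suc) T) (∪-identityʳ S)) (*-comm (q zero) _)
∏-∪⁅⁆ q (inside  ∷ S) {suc i} i∉S =
  trans (cong (q zero *_) (∏-∪⁅⁆ (q ∘ suc) S (i∉S ∘ there))) (sym (*-assoc (q zero) _ _))
∏-∪⁅⁆ q (outside ∷ S) {suc i} i∉S = ∏-∪⁅⁆ (q ∘ suc) S (i∉S ∘ there)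

∏-zero : ∀ {n} (q : Fin n → ℚ) {S i} → i ∈ S → q i ≡ 0ℚ → ∏ q S ≡ 0ℚ
∏-zero q {inside ∷ S} here      qi≡0 = trans (cong (_* ∏ (q ∘ suc) S) qi≡0) (*-zeroˡ (∏ (q ∘ suc) S))
∏-zero q {inside  ∷ S} (there i∈S) qi≡0 = trans (cong (q zero *_) (∏-zero (q ∘ suc) i∈S qi≡0)) (*-zeroʳ (q zero))
∏-zero q {outside ∷ S} (there i∈S) qi≡0 = ∏-zero (q ∘ suc) i∈S qi≡0

Probabilities : ∀ {n} → (Fin n → ℚ) → Set
Probabilities q = ∀ i → q i ∈[0,1]

∏-∈[0,1] : ∀ {n} {q : Fin n → ℚ} → Probabilities q → ∀ S → ∏ q S ∈[0,1]
∏-∈[0,1] q∈ [] = 0≤1 , ≤-refl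
∏-∈[0,1] {q = q} q∈ (inside ∷ S) =
  let (0≤q , q≤1) = q∈ zero ; (0≤∏ , ∏≤1) = ∏-∈[0,1] (q∈ ∘ suc) S
  in *-nonNeg 0≤q 0≤∏ , subst (q zero * ∏ (q ∘ suc) S ≤_) (*-identityˡ 1ℚ) (*-mono-≤-nonNeg 0≤q 0≤∏ q≤1 ∏≤1)
∏-∈[0,1] q∈ (outside ∷ S) = ∏-∈[0,1] (q∈ ∘ suc) S

∏-antitone : ∀ {n} {q : Fin n → ℚ} → Probabilities q → ∀ {S T} → S ⊆ T → ∏ q T ≤ ∏ q S
∏-antitone q∈ {[]} {[]} _ = ≤-refl
∏-antitone {q = q} q∈ {inside ∷ S} {inside ∷ T} S⊆T =
  *-monoˡ-≤-nonNeg (q zero) {{nonNegative (proj₁ (q∈ zero))}} (∏-antitone (q∈ ∘ suc) (drop-∷-⊆ S⊆T))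
∏-antitone q∈ {inside ∷ S} {outside ∷ T} S⊆T with () ← S⊆T here
∏-antitone {q = q} q∈ {outside ∷ S} {inside ∷ T} S⊆T = begin
  q zero * ∏ (q ∘ suc) T ≤⟨ *-monoʳ-≤-nonNeg (∏ (q ∘ suc) T) {{nonNegative (proj₁ (∏-∈[0,1] (q∈ ∘ suc) T))}}
                                              (proj₂ (q∈ zero)) ⟩
  1ℚ * ∏ (q ∘ suc) T     ≡⟨ *-identityˡ (∏ (q ∘ suc) T) ⟩
  ∏ (q ∘ suc) T          ≤⟨ ∏-antitone (q∈ ∘ suc) (drop-∷-⊆ S⊆T) ⟩
  ∏ (q ∘ suc) S          ∎
  where open ≤-Reasoning
∏-antitone q∈ {outside ∷ S} {outside ∷ T} S⊆T = ∏-antitone (q∈ ∘ suc) (drop-∷-⊆ S⊆T)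

∏-supermodular : ∀ {n} {q : Fin n → ℚ} → Probabilities q →
                 ∀ S T → ∏ q S + ∏ q T ≤ ∏ q (S ∪ T) + ∏ q (S ∩ T)
∏-supermodular q∈ [] [] = ≤-refl
∏-supermodular {q = q} q∈ (inside ∷ S) (inside ∷ T) =
  subst₂ _≤_ (*-distribˡ-+ (q zero) _ _) (*-distribˡ-+ (q zero) _ _)
    (*-monoˡ-≤-nonNeg (q zero) {{nonNegative (proj₁ (q∈ zero))}} (∏-supermodular (q∈ ∘ suc) S T))
∏-supermodular q∈ (inside ∷ S) (outside ∷ T) =
  +-≤-scaleˡ (q∈ zero) (∏-antitone (q∈ ∘ suc) (p⊆p∪q {p = S} T)) (∏-supermodular (q∈ ∘ suc) S T)
∏-supermodular {q = q} q∈ (outside ∷ S) (inside ∷ T) =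
  subst (_≤ q zero * ∏ q′ (S ∪ T) + ∏ q′ (S ∩ T)) (+-comm (q zero * ∏ q′ T) (∏ q′ S))
    (+-≤-scaleˡ (q∈ zero) (∏-antitone (q∈ ∘ suc) (q⊆p∪q S T))
      (subst (_≤ ∏ q′ (S ∪ T) + ∏ q′ (S ∩ T)) (+-comm (∏ q′ S) (∏ q′ T)) (∏-supermodular (q∈ ∘ suc) S T)))
  where q′ = q ∘ suc
∏-supermodular q∈ (outside ∷ S) (outside ∷ T) = ∏-supermodular (q∈ ∘ suc) S T

-- Coverage functions: v times the probability that an item, missed by each element i
-- independently with probability q i, is covered by S.

coverage : ∀ {n} → ℚ → (Fin n → ℚ) → SetFn n
coverage v q S = v * (1ℚ - ∏ q S)

module _ {n} {v : ℚ} {q : Fin n → ℚ} (0≤v : 0ℚ ≤ v) (q∈ : Probabilities q) where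

  coverage-nonNegative : NonNegative (coverage v q)
  coverage-nonNegative S = *-nonNeg 0≤v (≤⇒0≤- (proj₂ (∏-∈[0,1] q∈ S)))

  coverage-≤ : ∀ S → coverage v q S ≤ v
  coverage-≤ S = subst (coverage v q S ≤_) (*-identityʳ v)
    (*-monoˡ-≤-nonNeg v {{nonNegative 0≤v}} (+-monoʳ-≤ 1ℚ (neg-antimono-≤ (proj₁ (∏-∈[0,1] q∈ S)))))

  coverage-monotone : Monotone (coverage v q)
  coverage-monotone S T S⊆T =
    *-monoˡ-≤-nonNeg v {{nonNegative 0≤v}} (+-monoʳ-≤ 1ℚ (neg-antimono-≤ (∏-antitone q∈ S⊆T)))

  coverage-submodular : Submodular (coverage v q)
  coverage-submodular S T =
    ≤-by-gap (*-nonNeg 0≤v (≤⇒0≤- (∏-supermodular q∈ S T)))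
             (gap v (∏ q S) (∏ q T) (∏ q (S ∪ T)) (∏ q (S ∩ T)))
    where
    gap : ∀ v x y u z → v * (1ℚ - u) + v * (1ℚ - z) + v * ((u + z) - (x + y))
                        ≡ v * (1ℚ - x) + v * (1ℚ - y)
    gap = solve-∀ ℚ-ring

coverage-marginal : ∀ {n} v (q : Fin n → ℚ) A {i} → i ∉ A →
                    marginal (coverage v q) A ⁅ i ⁆ ≡ v * ∏ q A * (1ℚ - q i)
coverage-marginal v q A {i} i∉A = begin
  v * (1ℚ - ∏ q (A ∪ ⁅ i ⁆)) - v * (1ℚ - ∏ q A) ≡⟨ cong (λ x → v * (1ℚ - x) - v * (1ℚ - ∏ q A)) (∏-∪⁅⁆ q A i∉A) ⟩
  v * (1ℚ - ∏ q A * q i) - v * (1ℚ - ∏ q A)     ≡⟨ expand v (∏ q A) (q i) ⟩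
  v * ∏ q A * (1ℚ - q i)                        ∎
  where
  open ≡-Reasoning
  expand : ∀ v P x → v * (1ℚ - P * x) - v * (1ℚ - P) ≡ v * P * (1ℚ - x)
  expand = solve-∀ ℚ-ring

coverage-covered : ∀ {n} v (q : Fin n → ℚ) {S i} → i ∈ S → q i ≡ 0ℚ → coverage v q S ≡ v
coverage-covered v q i∈S qi≡0 =
  trans (cong (λ x → v * (1ℚ - x)) (∏-zero q i∈S qi≡0)) (*-identityʳ v)

infixl 6 _⊕_

_⊕_ : ∀ {n} → SetFn n → SetFn n → SetFn n
(f ⊕ g) S = f S + g S

module _ {n} {f g : SetFn n} where

  ⊕-nonNegative : NonNegative f → NonNegative g → NonNegative (f ⊕ g)
  ⊕-nonNegative f≥0 g≥0 S = subst (_≤ (f ⊕ g) S) (+-identityʳ 0ℚ) (+-mono-≤ (f≥0 S) (g≥0 S))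

  ⊕-monotone : Monotone f → Monotone g → Monotone (f ⊕ g)
  ⊕-monotone f↑ g↑ S T S⊆T = +-mono-≤ (f↑ S T S⊆T) (g↑ S T S⊆T)

  ⊕-submodular : Submodular f → Submodular g → Submodular (f ⊕ g)
  ⊕-submodular f-sub g-sub S T = subst₂ _≤_
    (interchange (f (S ∪ T)) (f (S ∩ T)) (g (S ∪ T)) (g (S ∩ T)))
    (interchange (f S) (f T) (g S) (g T))
    (+-mono-≤ (f-sub S T) (g-sub S T))
    where
    interchange : ∀ a b c d → (a + b) + (c + d) ≡ (a + c) + (b + d)
    interchange = solve-∀ ℚ-ring


⊕-marginal : ∀ {n} (f g : SetFn n) A S → marginal (f ⊕ g) A S ≡ marginal f A S + marginal g A S
⊕-marginal f g A S = regroup (f (A ∪ S)) (g (A ∪ S)) (f A) (g A)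
  where
  regroup : ∀ a b c d → (a + b) - (c + d) ≡ (a - c) + (b - d)
  regroup = solve-∀ ℚ-ring

weight-⊥ : ∀ {n} (w : Fin n → ℕ) → weight w ⊥ ≡ 0
weight-⊥ {zero}  w = refl
weight-⊥ {suc n} w = weight-⊥ (w ∘ suc)

weight-∪⁅⁆ : ∀ {n} (w : Fin n → ℕ) S {i} → i ∉ S → weight w (S ∪ ⁅ i ⁆) ≡ weight w S ℕ.+ w i
weight-∪⁅⁆ w (inside  ∷ S) {zero}  i∉S = contradiction here i∉S
weight-∪⁅⁆ w (outside ∷ S) {zero}  _   =
  trans (cong (λ T → w zero ℕ.+ weight (w ∘ suc) T) (∪-identityʳ S)) (ℕₚ.+-comm (w zero) _)
weight-∪⁅⁆ w (inside  ∷ S) {suc i} i∉S =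
  trans (cong (w zero ℕ.+_) (weight-∪⁅⁆ (w ∘ suc) S (i∉S ∘ there))) (sym (ℕₚ.+-assoc (w zero) _ _))
weight-∪⁅⁆ w (outside ∷ S) {suc i} i∉S = weight-∪⁅⁆ (w ∘ suc) S (i∉S ∘ there)

weight-mono : ∀ {n} (w : Fin n → ℕ) {S T} → S ⊆ T → weight w S ℕ.≤ weight w T
weight-mono w {[]}          {[]}          _   = ℕₚ.≤-refl
weight-mono w {inside  ∷ S} {inside  ∷ T} S⊆T = ℕₚ.+-monoʳ-≤ (w zero) (weight-mono (w ∘ suc) (drop-∷-⊆ S⊆T))
weight-mono w {inside  ∷ S} {outside ∷ T} S⊆T with () ← S⊆T here
weight-mono w {outside ∷ S} {inside  ∷ T} S⊆T =
  ℕₚ.≤-trans (weight-mono (w ∘ suc) (drop-∷-⊆ S⊆T)) (ℕₚ.m≤n+m _ (w zero))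
weight-mono w {outside ∷ S} {outside ∷ T} S⊆T = weight-mono (w ∘ suc) (drop-∷-⊆ S⊆T)

-- Initial and final segments of the ground set: initial k = {i | i < k}, final k = {i | k ≤ i}

initial : ∀ {n} → ℕ → Subset n
initial {zero}  _       = []
initial {suc n} zero    = ⊥
initial {suc n} (suc k) = inside ∷ initial k

final : ∀ {n} → ℕ → Subset n
final {zero}  _       = []
final {suc n} zero    = ⊤
final {suc n} (suc k) = outside ∷ final k

initial-zero : ∀ {n} → initial {n} 0 ≡ ⊥
initial-zero {zero}  = refl
initial-zero {suc n} = refl

final-zero : ∀ {n} → final {n} 0 ≡ ⊤
final-zero {zero}  = refl
final-zero {suc n} = refl

initial-suc : ∀ {n k} (k<n : k ℕ.< n) → initial (suc k) ≡ initial k ∪ ⁅ fromℕ< k<n ⁆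
initial-suc {suc n} {zero}  _         = cong (inside ∷_) (trans initial-zero (sym (∪-identityˡ ⊥)))
initial-suc {suc n} {suc k} (s≤s k<n) = cong (inside ∷_) (initial-suc k<n)

final-suc : ∀ {n k} (k<n : k ℕ.< n) → final (suc k) ≡ final k ∖ fromℕ< k<n
final-suc {suc n} {zero}  _         = cong (outside ∷_) (trans final-zero (sym (p─⊥≡p ⊤)))
final-suc {suc n} {suc k} (s≤s k<n) = cong (outside ∷_) (final-suc k<n)

initial-mono : ∀ {n k l} → k ℕ.≤ l → initial {n} k ⊆ initial l
initial-mono {suc n} {zero}  _         = ⊥⊆
initial-mono {suc n} {suc k} (s≤s k≤l) here        = here
initial-mono {suc n} {suc k} (s≤s k≤l) (there i∈) = there (initial-mono k≤l i∈)

≤⇒∉initial : ∀ {n k} {i : Fin n} → k ℕ.≤ toℕ i → i ∉ initial k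
≤⇒∉initial {suc n} {zero}          _         = ∉⊥
≤⇒∉initial {suc n} {suc k} {suc i} (s≤s k≤i) (there i∈) = ≤⇒∉initial k≤i i∈

∈final⇒≤ : ∀ {n k} {i : Fin n} → i ∈ final k → k ℕ.≤ toℕ i
∈final⇒≤ {suc n} {zero}          _          = z≤n
∈final⇒≤ {suc n} {suc k} {suc i} (there i∈) = s≤s (∈final⇒≤ i∈)

≤⇒∈final : ∀ {n k} {i : Fin n} → k ℕ.≤ toℕ i → i ∈ final k
≤⇒∈final {suc n} {zero}          _         = ∈⊤
≤⇒∈final {suc n} {suc k} {suc i} (s≤s k≤i) = there (≤⇒∈final k≤i)

fromℕ<∉initial : ∀ {n k} (k<n : k ℕ.< n) → fromℕ< k<n ∉ initial k
fromℕ<∉initial k<n = ≤⇒∉initial (ℕₚ.≤-reflexive (sym (Finₚ.toℕ-fromℕ< k<n)))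

fromℕ<∈final : ∀ {n k} (k<n : k ℕ.< n) → fromℕ< k<n ∈ final k
fromℕ<∈final k<n = ≤⇒∈final (ℕₚ.≤-reflexive (sym (Finₚ.toℕ-fromℕ< k<n)))

final-empty : ∀ {n} → Empty (final {n} n)
final-empty {suc n} (suc i , there i∈) = final-empty (i , i∈)

weight-final-suc : ∀ {n k} (w : Fin n → ℕ) (k<n : k ℕ.< n) →
                   weight w (final k) ≡ w (fromℕ< k<n) ℕ.+ weight w (final (suc k))
weight-final-suc {suc n} {zero}  w _         = cong (λ S → w zero ℕ.+ weight (w ∘ suc) S) (sym final-zero)
weight-final-suc {suc n} {suc k} w (s≤s k<n) = weight-final-suc (w ∘ suc) k<n

weight-final-empty : ∀ {n} (w : Fin n → ℕ) → weight w (final n) ≡ 0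
weight-final-empty {n} w = trans (cong (weight w) (Empty-unique final-empty)) (weight-⊥ w)

∏-initial-suc : ∀ {n k} (q : Fin n → ℚ) (k<n : k ℕ.< n) →
                ∏ q (initial (suc k)) ≡ ∏ q (initial k) * q (fromℕ< k<n)
∏-initial-suc q k<n = trans (cong (∏ q) (initial-suc k<n))
  (∏-∪⁅⁆ q _ (fromℕ<∉initial k<n))

weight-initial-suc : ∀ {n k} (w : Fin n → ℕ) (k<n : k ℕ.< n) →
                     weight w (initial (suc k)) ≡ weight w (initial k) ℕ.+ w (fromℕ< k<n)
weight-initial-suc w k<n = trans (cong (weight w) (initial-suc k<n))
  (weight-∪⁅⁆ w _ (fromℕ<∉initial k<n))

ConstantOn : ∀ {A : Set} {n} → (Fin n → A) → A → ℕ → ℕ → Set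
ConstantOn g x m j = ∀ i → m ℕ.≤ toℕ i → toℕ i ℕ.< m ℕ.+ j → g i ≡ x

ConstantOn-≤ : ∀ {A : Set} {n} {g : Fin n → A} {x m j k} → j ℕ.≤ k → ConstantOn g x m k → ConstantOn g x m j
ConstantOn-≤ {m = m} j≤k g≡x i m≤i i<m+j = g≡x i m≤i (ℕₚ.<-≤-trans i<m+j (ℕₚ.+-monoʳ-≤ m j≤k))

ConstantOn-last : ∀ {A : Set} {n} {g : Fin n → A} {x m j} (m+j<n : m ℕ.+ j ℕ.< n) →
                  ConstantOn g x m (suc j) → g (fromℕ< m+j<n) ≡ x
ConstantOn-last {m = m} {j} m+j<n g≡x = g≡x (fromℕ< m+j<n)
  (subst (m ℕ.≤_) (sym (Finₚ.toℕ-fromℕ< m+j<n)) (ℕₚ.m≤m+n m j))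
  (subst (ℕ._< m ℕ.+ suc j) (sym (Finₚ.toℕ-fromℕ< m+j<n)) (ℕₚ.+-monoʳ-< m (ℕₚ.n<1+n j)))

∏-initial-block : ∀ {n} (q : Fin n → ℚ) {x} m j → m ℕ.+ j ℕ.≤ n → ConstantOn q x m j →
                  ∏ q (initial (m ℕ.+ j)) ≡ ∏ q (initial m) * x ^ j
∏-initial-block q m zero _ _ =
  trans (cong (∏ q ∘ initial) (ℕₚ.+-identityʳ m)) (sym (*-identityʳ (∏ q (initial m))))
∏-initial-block {n} q {x} m (suc j) m+j<n q≡x = begin
  ∏ q (initial (m ℕ.+ suc j))                    ≡⟨ cong (∏ q ∘ initial) (ℕₚ.+-suc m j) ⟩
  ∏ q (initial (suc (m ℕ.+ j)))                  ≡⟨ ∏-initial-suc q m+j<n′ ⟩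
  ∏ q (initial (m ℕ.+ j)) * q (fromℕ< m+j<n′)   ≡⟨ cong₂ _*_ (∏-initial-block q m j (ℕₚ.<⇒≤ m+j<n′)
                                                                (ConstantOn-≤ (ℕₚ.n≤1+n j) q≡x))
                                                              (ConstantOn-last m+j<n′ q≡x) ⟩
  ∏ q (initial m) * x ^ j * x                    ≡⟨ *-assoc (∏ q (initial m)) (x ^ j) x ⟩
  ∏ q (initial m) * (x ^ j * x)                  ≡⟨ cong (∏ q (initial m) *_) (*-comm (x ^ j) x) ⟩
  ∏ q (initial m) * x ^ suc j                    ∎
  where
  open ≡-Reasoning
  m+j<n′ : m ℕ.+ j ℕ.< n
  m+j<n′ = subst (ℕ._≤ n) (ℕₚ.+-suc m j) m+j<n

weight-initial-block : ∀ {n} (w : Fin n → ℕ) {x} m j → m ℕ.+ j ℕ.≤ n → ConstantOn w x m j →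
                       weight w (initial (m ℕ.+ j)) ≡ weight w (initial m) ℕ.+ j ℕ.* x
weight-initial-block w m zero _ _ =
  trans (cong (weight w ∘ initial) (ℕₚ.+-identityʳ m)) (sym (ℕₚ.+-identityʳ (weight w (initial m))))
weight-initial-block {n} w {x} m (suc j) m+j<n w≡x = begin
  weight w (initial (m ℕ.+ suc j))                     ≡⟨ cong (weight w ∘ initial) (ℕₚ.+-suc m j) ⟩
  weight w (initial (suc (m ℕ.+ j)))                   ≡⟨ weight-initial-suc w m+j<n′ ⟩
  weight w (initial (m ℕ.+ j)) ℕ.+ w (fromℕ< m+j<n′)  ≡⟨ cong₂ ℕ._+_ (weight-initial-block w m j (ℕₚ.<⇒≤ m+j<n′)
                                                                      (ConstantOn-≤ (ℕₚ.n≤1+n j) w≡x))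
                                                                    (ConstantOn-last m+j<n′ w≡x) ⟩
  weight w (initial m) ℕ.+ j ℕ.* x ℕ.+ x               ≡⟨ ℕ-solve (weight w (initial m)) j x ⟩
  weight w (initial m) ℕ.+ suc j ℕ.* x                 ∎
  where
  open ≡-Reasoning
  m+j<n′ : m ℕ.+ j ℕ.< n
  m+j<n′ = subst (ℕ._≤ n) (ℕₚ.+-suc m j) m+j<n
  ℕ-solve : ∀ a j x → a ℕ.+ j ℕ.* x ℕ.+ x ≡ a ℕ.+ (x ℕ.+ j ℕ.* x)
  ℕ-solve = ℕ-solve-∀

addIfFits-fits : ∀ {n} (w : Fin n → ℕ) W A e → weight w (A ∪ ⁅ e ⁆) ℕ.≤ W → addIfFits w W A e ≡ A ∪ ⁅ e ⁆
addIfFits-fits w W A e fits with weight w (A ∪ ⁅ e ⁆) ℕ.≤? W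
... | yes _    = refl
... | no ¬fits = contradiction fits ¬fits

addIfFits-overflows : ∀ {n} (w : Fin n → ℕ) W A e → W ℕ.< weight w (A ∪ ⁅ e ⁆) → addIfFits w W A e ≡ A
addIfFits-overflows w W A e overflows with weight w (A ∪ ⁅ e ⁆) ℕ.≤? W
... | yes fits = contradiction fits (ℕₚ.<⇒≱ overflows)
... | no _     = refl

-- A k is the solution after the indices 0, …, k - 1 have been processed, in this order.
greedy-in-index-order : ∀ {n} (f : SetFn n) (w : Fin n → ℕ) W (A : ℕ → Subset n) → A 0 ≡ ⊥ →
  (∀ k (k<n : k ℕ.< n) → A (suc k) ≡ addIfFits w W (A k) (fromℕ< k<n)) →
  (∀ k (k<n : k ℕ.< n) e → e ∈ final k → density f w (A k) e ≤ density f w (A k) (fromℕ< k<n)) →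
  Greedy f w W (A n)
greedy-in-index-order {n} f w W A A0≡⊥ A-suc greedy-choice =
  subst₂ (λ E B → GreedyRun f w W E B (A n)) final-zero A0≡⊥ (run-from n 0 (ℕₚ.+-identityʳ n))
  where
  run-from : ∀ d k → d ℕ.+ k ≡ n → GreedyRun f w W (final k) (A k) (A n)
  run-from zero    k refl    = done final-empty
  run-from (suc d) k d+k≡n =
    step (fromℕ< k<n) (fromℕ<∈final k<n) (greedy-choice k k<n)
      (subst₂ (λ E B → GreedyRun f w W E B (A n)) (final-suc k<n) (A-suc k k<n)
        (run-from d (suc k) (trans (ℕₚ.+-suc d k) d+k≡n)))
    where
    k<n : k ℕ.< n
    k<n = subst (k ℕ.<_) d+k≡n (ℕₚ.m<n+m k (s≤s z≤n))

-- The instance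

data Kind : Set where
  small medium single big₁ big₂ : Kind

Big : Kind → Set
Big κ = κ ≡ big₁ ⊎ κ ≡ big₂

-- An element of kind κ misses item j with probability qⱼ κ; items 1, 2 and 3 have values a, a and c.
module Instance (KA KB mA mB wb wS : ℕ)
                {{_ : NonZero mA}} {{_ : NonZero mB}} {{_ : NonZero wb}} {{_ : NonZero wS}}
                (r t : ℚ) where

  N m n W : ℕ
  N = KA ℕ.+ KB
  m = suc N
  n = suc (suc m)
  W = wb ℕ.+ wb ℕ.+ wS

  kind : ℕ → Kind
  kind j = if does (j ℕ.<? KA) then small
           else if does (j ℕ.<? N) then medium
           else if does (j ℕ.≟ N) then single
           else if does (j ℕ.≟ m) then big₁
           else big₂

  q₁ q₂ q₃ : Kind → ℚ
  q₁ small = 1ℚ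
  q₁ medium = t
  q₁ single = 1ℚ
  q₁ big₁ = 0ℚ
  q₁ big₂ = 1ℚ
  q₂ small = 1ℚ
  q₂ medium = t
  q₂ single = 1ℚ
  q₂ big₁ = 1ℚ
  q₂ big₂ = 0ℚ
  q₃ small = r
  q₃ medium = t
  q₃ single = 0ℚ
  q₃ big₁ = 1ℚ
  q₃ big₂ = 1ℚ

  weightOf : Kind → ℕ
  weightOf small  = mA
  weightOf medium = mB
  weightOf single = wS
  weightOf big₁   = wb
  weightOf big₂   = wb

  rK tK a c : ℚ
  rK = r ^ KA
  tK = t ^ KB
  a  = ⌜ wb ⌝ * rK
  c  = ⌜ wS ⌝

  kindOf : Fin n → Kind
  kindOf = kind ∘ toℕ

  cover₁ cover₂ cover₃ f : SetFn n
  cover₁ = coverage a (q₁ ∘ kindOf)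
  cover₂ = coverage a (q₂ ∘ kindOf)
  cover₃ = coverage c (q₃ ∘ kindOf)
  f = cover₁ ⊕ cover₂ ⊕ cover₃

  w : Fin n → ℕ
  w = weightOf ∘ kindOf

  gain : Kind → ℚ → ℚ → ℚ → ℚ
  gain κ P₁ P₂ P₃ = a * P₁ * (1ℚ - q₁ κ) + a * P₂ * (1ℚ - q₂ κ) + c * P₃ * (1ℚ - q₃ κ)

  value : Kind → ℚ
  value κ = a * (1ℚ - q₁ κ) + a * (1ℚ - q₂ κ) + c * (1ℚ - q₃ κ)

  -- The state of Greedy after k steps: it takes the first m elements and rejects the big ones.
  greedyState : ℕ → Subset n
  greedyState k = initial (k ℕ.⊓ m)

  W-nonZero : NonZero W
  W-nonZero = ℕ.>-nonZero (ℕₚ.<-≤-trans (ℕ.>-nonZero⁻¹ wS) (ℕₚ.m≤n+m wS (wb ℕ.+ wb)))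

  weightOf-nonZero : ∀ κ → NonZero (weightOf κ)
  weightOf-nonZero small  = it
  weightOf-nonZero medium = it
  weightOf-nonZero single = it
  weightOf-nonZero big₁   = it
  weightOf-nonZero big₂   = it

  Big⇒weight : ∀ {κ} → Big κ → weightOf κ ≡ wb
  Big⇒weight (inj₁ refl) = refl
  Big⇒weight (inj₂ refl) = refl

  KA≤N : KA ℕ.≤ N
  KA≤N = ℕₚ.m≤m+n KA KB

  kind-small : ∀ {j} → j ℕ.< KA → kind j ≡ small
  kind-small {j} j<KA rewrite dec-true (j ℕ.<? KA) j<KA = refl

  kind-medium : ∀ {j} → KA ℕ.≤ j → j ℕ.< N → kind j ≡ medium
  kind-medium {j} KA≤j j<N rewrite dec-false (j ℕ.<? KA) (ℕₚ.≤⇒≯ KA≤j) | dec-true (j ℕ.<? N) j<N = refl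

  kind-single : kind N ≡ single
  kind-single rewrite dec-false (N ℕ.<? KA) (ℕₚ.≤⇒≯ KA≤N) | dec-false (N ℕ.<? N) (ℕₚ.<-irrefl refl)
                    | dec-true (N ℕ.≟ N) refl = refl

  kind-big₁ : kind m ≡ big₁
  kind-big₁ rewrite dec-false (m ℕ.<? KA) (ℕₚ.≤⇒≯ (ℕₚ.m≤n⇒m≤1+n KA≤N))
                  | dec-false (m ℕ.<? N) (ℕₚ.≤⇒≯ (ℕₚ.n≤1+n N))
                  | dec-false (m ℕ.≟ N) ℕₚ.1+n≢n | dec-true (m ℕ.≟ m) refl = refl

  kind-big₂ : kind (suc m) ≡ big₂
  kind-big₂ rewrite dec-false (suc m ℕ.<? KA) (ℕₚ.≤⇒≯ (ℕₚ.m≤n⇒m≤1+n (ℕₚ.m≤n⇒m≤1+n KA≤N)))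
                  | dec-false (suc m ℕ.<? N) (ℕₚ.≤⇒≯ (ℕₚ.m≤n⇒m≤1+n (ℕₚ.n≤1+n N)))
                  | dec-false (suc m ℕ.≟ N) (ℕₚ.<⇒≢ (ℕₚ.m<n⇒m<1+n (ℕₚ.n<1+n N)) ∘ sym)
                  | dec-false (suc m ℕ.≟ m) ℕₚ.1+n≢n = refl

  kind-big : ∀ {j} → m ℕ.≤ j → j ℕ.< n → Big (kind j)
  kind-big m≤j j<n with ℕₚ.m≤n⇒m<n∨m≡n m≤j
  ... | inj₂ refl = inj₁ kind-big₁
  ... | inj₁ m<j with ℕₚ.m≤n⇒m<n∨m≡n m<j
  ...   | inj₂ refl = inj₂ kind-big₂
  ...   | inj₁ 1+m<j = contradiction j<n (ℕₚ.≤⇒≯ 1+m<j)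

  kind-not-small : ∀ {j} → KA ℕ.≤ j → j ℕ.< n → kind j ≢ small
  kind-not-small {j} KA≤j j<n is-small with ℕₚ.<-cmp j N
  ... | tri< j<N _ _  with () ← trans (sym (kind-medium KA≤j j<N)) is-small
  ... | tri≈ _ refl _ with () ← trans (sym kind-single) is-small
  ... | tri> _ _ N<j  with kind-big N<j j<n
  ...   | inj₁ big with () ← trans (sym big) is-small
  ...   | inj₂ big with () ← trans (sym big) is-small

  P : (Kind → ℚ) → ℕ → ℚ
  P q k = ∏ (q ∘ kindOf) (initial k)

  N<n : N ℕ.< n
  N<n = ℕₚ.m<n⇒m<1+n (ℕₚ.m<n⇒m<1+n (ℕₚ.n<1+n N))

  m<n : m ℕ.< n
  m<n = ℕₚ.m<n⇒m<1+n (ℕₚ.n<1+n m)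

  1+m<n : suc m ℕ.< n
  1+m<n = ℕₚ.n<1+n (suc m)

  N≤n : N ℕ.≤ n
  N≤n = ℕₚ.<⇒≤ N<n

  kindOf-fromℕ< : ∀ {k} (k<n : k ℕ.< n) → kindOf (fromℕ< k<n) ≡ kind k
  kindOf-fromℕ< k<n = cong kind (Finₚ.toℕ-fromℕ< k<n)

  kindOf-N : kindOf (fromℕ< N<n) ≡ single
  kindOf-N = trans (kindOf-fromℕ< N<n) kind-single

  small-block : ∀ {A : Set} (g : Kind → A) → ConstantOn (g ∘ kindOf) (g small) 0 KA
  small-block g i _ i<KA = cong g (kind-small i<KA)

  medium-block : ∀ {A : Set} (g : Kind → A) → ConstantOn (g ∘ kindOf) (g medium) KA KB
  medium-block g i KA≤i i<N = cong g (kind-medium KA≤i i<N)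

  P-small : ∀ q {k} → k ℕ.≤ KA → P q k ≡ q small ^ k
  P-small q {k} k≤KA = begin
    P q k                                    ≡⟨ ∏-initial-block (q ∘ kindOf) 0 k k≤n (ConstantOn-≤ k≤KA (small-block q)) ⟩
    ∏ (q ∘ kindOf) (initial 0) * q small ^ k ≡⟨ cong (λ S → ∏ (q ∘ kindOf) S * q small ^ k) initial-zero ⟩
    ∏ (q ∘ kindOf) ⊥ * q small ^ k           ≡⟨ cong (_* q small ^ k) (∏-⊥ (q ∘ kindOf)) ⟩
    1ℚ * q small ^ k                         ≡⟨ *-identityˡ (q small ^ k) ⟩
    q small ^ k                              ∎
    where
    open ≡-Reasoning
    k≤n : k ℕ.≤ n
    k≤n = ℕₚ.≤-trans k≤KA (ℕₚ.≤-trans KA≤N N≤n)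

  P-medium : ∀ q {j} → j ℕ.≤ KB → P q (KA ℕ.+ j) ≡ q small ^ KA * q medium ^ j
  P-medium q {j} j≤KB = begin
    P q (KA ℕ.+ j)              ≡⟨ ∏-initial-block (q ∘ kindOf) KA j KA+j≤n (ConstantOn-≤ j≤KB (medium-block q)) ⟩
    P q KA * q medium ^ j       ≡⟨ cong (_* q medium ^ j) (P-small q ℕₚ.≤-refl) ⟩
    q small ^ KA * q medium ^ j ∎
    where
    open ≡-Reasoning
    KA+j≤n : KA ℕ.+ j ℕ.≤ n
    KA+j≤n = ℕₚ.≤-trans (ℕₚ.+-monoʳ-≤ KA j≤KB) N≤n

  P-medium-t : ∀ q {j} → q small ≡ 1ℚ → q medium ≡ t → j ℕ.≤ KB → P q (KA ℕ.+ j) ≡ t ^ j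
  P-medium-t q {j} q-small q-medium j≤KB = begin
    P q (KA ℕ.+ j)              ≡⟨ P-medium q j≤KB ⟩
    q small ^ KA * q medium ^ j ≡⟨ cong₂ (λ x y → x ^ KA * y ^ j) q-small q-medium ⟩
    1ℚ ^ KA * t ^ j             ≡⟨ cong (_* t ^ j) (1^k≡1 KA) ⟩
    1ℚ * t ^ j                  ≡⟨ *-identityˡ (t ^ j) ⟩
    t ^ j                       ∎
    where open ≡-Reasoning

  P₁-greedy : P q₁ m ≡ tK
  P₁-greedy = trans (∏-initial-suc (q₁ ∘ kindOf) N<n)
    (trans (cong₂ _*_ (P-medium-t q₁ refl refl ℕₚ.≤-refl) (cong q₁ kindOf-N)) (*-identityʳ tK))

  P₂-greedy : P q₂ m ≡ tK
  P₂-greedy = trans (∏-initial-suc (q₂ ∘ kindOf) N<n)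
    (trans (cong₂ _*_ (P-medium-t q₂ refl refl ℕₚ.≤-refl) (cong q₂ kindOf-N)) (*-identityʳ tK))

  P₃-greedy : P q₃ m ≡ 0ℚ
  P₃-greedy = trans (∏-initial-suc (q₃ ∘ kindOf) N<n)
    (trans (cong (P q₃ N *_) (cong q₃ kindOf-N)) (*-zeroʳ (P q₃ N)))

  gain-cong : ∀ κ {P₁ P₁′ P₂ P₂′ P₃ P₃′} → P₁ ≡ P₁′ → P₂ ≡ P₂′ → P₃ ≡ P₃′ →
              gain κ P₁ P₂ P₃ ≡ gain κ P₁′ P₂′ P₃′
  gain-cong κ refl refl refl = refl

  marginal-gain : ∀ A {e} → e ∉ A →
    marginal f A ⁅ e ⁆ ≡ gain (kindOf e) (∏ (q₁ ∘ kindOf) A) (∏ (q₂ ∘ kindOf) A) (∏ (q₃ ∘ kindOf) A)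
  marginal-gain A {e} e∉A = trans (⊕-marginal (cover₁ ⊕ cover₂) cover₃ A ⁅ e ⁆) (cong₂ _+_
    (trans (⊕-marginal cover₁ cover₂ A ⁅ e ⁆) (cong₂ _+_ (coverage-marginal a _ A e∉A) (coverage-marginal a _ A e∉A)))
    (coverage-marginal c _ A e∉A))

  marginal-small-phase : ∀ {k e} → k ℕ.≤ KA → e ∉ initial k →
                         marginal f (initial k) ⁅ e ⁆ ≡ gain (kindOf e) 1ℚ 1ℚ (r ^ k)
  marginal-small-phase {k} {e} k≤KA e∉ = trans (marginal-gain (initial k) e∉) (gain-cong (kindOf e)
    (trans (P-small q₁ k≤KA) (1^k≡1 k)) (trans (P-small q₂ k≤KA) (1^k≡1 k)) (P-small q₃ k≤KA))

  marginal-medium-phase : ∀ {j e} → j ℕ.≤ KB → e ∉ initial (KA ℕ.+ j) →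
    marginal f (initial (KA ℕ.+ j)) ⁅ e ⁆ ≡ gain (kindOf e) (t ^ j) (t ^ j) (rK * t ^ j)
  marginal-medium-phase {j} {e} j≤KB e∉ = trans (marginal-gain (initial (KA ℕ.+ j)) e∉)
    (gain-cong (kindOf e) (P-medium-t q₁ refl refl j≤KB) (P-medium-t q₂ refl refl j≤KB) (P-medium q₃ j≤KB))

  marginal-final-phase : ∀ {e} → e ∉ initial m → marginal f (initial m) ⁅ e ⁆ ≡ gain (kindOf e) tK tK 0ℚ
  marginal-final-phase {e} e∉ =
    trans (marginal-gain (initial m) e∉) (gain-cong (kindOf e) P₁-greedy P₂-greedy P₃-greedy)

  density-≡ : ∀ A {e} R → marginal f A ⁅ e ⁆ ≡ R * ⌜ w e ⌝ → density f w A e ≡ R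
  density-≡ A {e} R marginal≡ =
    trans (cong (λ x → divℕ x (w e)) marginal≡) (divℕ-* R (w e) {{weightOf-nonZero (kindOf e)}})

  density-≤ : ∀ A {e} R → marginal f A ⁅ e ⁆ ≤ R * ⌜ w e ⌝ → density f w A e ≤ R
  density-≤ A {e} R marginal≤ =
    subst (density f w A e ≤_) (divℕ-* R (w e) {{weightOf-nonZero (kindOf e)}}) (divℕ-mono-≤ (w e) marginal≤)

  ⌜W⌝ : ⌜ W ⌝ ≡ ⌜ wb ⌝ + ⌜ wb ⌝ + ⌜ wS ⌝
  ⌜W⌝ = trans (⌜⌝-+ (wb ℕ.+ wb) wS) (cong (_+ ⌜ wS ⌝) (⌜⌝-+ wb wb))

  greedyState-≤ : ∀ {k} → k ℕ.≤ m → greedyState k ≡ initial k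
  greedyState-≤ k≤m = cong initial (ℕₚ.m≤n⇒m⊓n≡m k≤m)

  greedyState-≥ : ∀ {k} → m ℕ.≤ k → greedyState k ≡ initial m
  greedyState-≥ m≤k = cong initial (ℕₚ.m≥n⇒m⊓n≡n m≤k)

  -- r and t are calibrated so that the densities tie along the run of Greedy.
  module Calibrated (r∈ : r ∈[0,1]) (t∈ : t ∈[0,1])
                    (small-calibrated : c * (1ℚ - r) ≡ ⌜ mA ⌝)
                    (medium-calibrated : ⌜ W ⌝ * (1ℚ - t) ≡ ⌜ mB ⌝)
                    (filler : KA ℕ.* mA ℕ.+ KB ℕ.* mB ≡ suc wb) where

    0≤rK : 0ℚ ≤ rK
    0≤rK = ^-nonNeg KA (proj₁ r∈)

    0≤1-t : 0ℚ ≤ 1ℚ - t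
    0≤1-t = ≤⇒0≤- (proj₂ t∈)

    medium-rate : ∀ x → (⌜ wb ⌝ * x + ⌜ wb ⌝ * x + c * x) * (1ℚ - t) ≡ x * ⌜ mB ⌝
    medium-rate x = begin
      (⌜ wb ⌝ * x + ⌜ wb ⌝ * x + c * x) * (1ℚ - t) ≡⟨ factor ⌜ wb ⌝ c x (1ℚ - t) ⟩
      x * ((⌜ wb ⌝ + ⌜ wb ⌝ + c) * (1ℚ - t))       ≡⟨ cong (λ y → x * (y * (1ℚ - t))) (sym ⌜W⌝) ⟩
      x * (⌜ W ⌝ * (1ℚ - t))                         ≡⟨ cong (x *_) medium-calibrated ⟩
      x * ⌜ mB ⌝                                     ∎
      where
      open ≡-Reasoning
      factor : ∀ b c x s → (b * x + b * x + c * x) * s ≡ x * ((b + b + c) * s)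
      factor = solve-∀ ℚ-ring

    gain-big : ∀ {κ} → Big κ → ∀ Q P₃ → gain κ Q Q P₃ ≡ rK * Q * ⌜ wb ⌝
    gain-big (inj₁ refl) Q P₃ = collect ⌜ wb ⌝ rK c Q P₃
      where
      collect : ∀ b ρ c Q P → b * ρ * Q * (1ℚ - 0ℚ) + b * ρ * Q * (1ℚ - 1ℚ) + c * P * (1ℚ - 1ℚ) ≡ ρ * Q * b
      collect = solve-∀ ℚ-ring
    gain-big (inj₂ refl) Q P₃ = collect ⌜ wb ⌝ rK c Q P₃
      where
      collect : ∀ b ρ c Q P → b * ρ * Q * (1ℚ - 1ℚ) + b * ρ * Q * (1ℚ - 0ℚ) + c * P * (1ℚ - 1ℚ) ≡ ρ * Q * b
      collect = solve-∀ ℚ-ring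

    gain-small-phase-small : ∀ R → gain small 1ℚ 1ℚ R ≡ R * ⌜ mA ⌝
    gain-small-phase-small R = trans (collect a c R r) (cong (R *_) small-calibrated)
      where
      collect : ∀ a c R r → a * 1ℚ * (1ℚ - 1ℚ) + a * 1ℚ * (1ℚ - 1ℚ) + c * R * (1ℚ - r) ≡ R * (c * (1ℚ - r))
      collect = solve-∀ ℚ-ring

    gain-small-phase-big : ∀ {κ R} → Big κ → rK ≤ R → gain κ 1ℚ 1ℚ R ≤ R * ⌜ wb ⌝
    gain-small-phase-big {κ} {R} κ-big rK≤R = begin
      gain κ 1ℚ 1ℚ R    ≡⟨ gain-big κ-big 1ℚ R ⟩
      rK * 1ℚ * ⌜ wb ⌝  ≡⟨ cong (_* ⌜ wb ⌝) (*-identityʳ rK) ⟩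
      rK * ⌜ wb ⌝       ≤⟨ *-monoʳ-≤-nonNeg ⌜ wb ⌝ {{nonNegative (⌜⌝-nonNeg wb)}} rK≤R ⟩
      R * ⌜ wb ⌝        ∎
      where open ≤-Reasoning

    gain-small-phase : ∀ κ {R} → rK ≤ R → gain κ 1ℚ 1ℚ R ≤ R * ⌜ weightOf κ ⌝
    gain-small-phase small  {R} _    = ≤-reflexive (gain-small-phase-small R)
    gain-small-phase medium {R} rK≤R = begin
      gain medium 1ℚ 1ℚ R                              ≡⟨ collect a c R t ⟩
      (a + a + c * R) * (1ℚ - t)                       ≤⟨ *-monoʳ-≤-nonNeg (1ℚ - t) {{nonNegative 0≤1-t}}
                                                            (+-monoˡ-≤ (c * R) (+-mono-≤ a≤ a≤)) ⟩
      (⌜ wb ⌝ * R + ⌜ wb ⌝ * R + c * R) * (1ℚ - t)   ≡⟨ medium-rate R ⟩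
      R * ⌜ mB ⌝                                       ∎
      where
      open ≤-Reasoning
      a≤ : a ≤ ⌜ wb ⌝ * R
      a≤ = *-monoˡ-≤-nonNeg ⌜ wb ⌝ {{nonNegative (⌜⌝-nonNeg wb)}} rK≤R
      collect : ∀ a c R t → a * 1ℚ * (1ℚ - t) + a * 1ℚ * (1ℚ - t) + c * R * (1ℚ - t) ≡ (a + a + c * R) * (1ℚ - t)
      collect = solve-∀ ℚ-ring
    gain-small-phase single {R} _ = ≤-reflexive (collect a c R)
      where
      collect : ∀ a c R → a * 1ℚ * (1ℚ - 1ℚ) + a * 1ℚ * (1ℚ - 1ℚ) + c * R * (1ℚ - 0ℚ) ≡ R * c
      collect = solve-∀ ℚ-ring
    gain-small-phase big₁ = gain-small-phase-big (inj₁ refl)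
    gain-small-phase big₂ = gain-small-phase-big (inj₂ refl)

    gain-medium-phase : ∀ κ → κ ≢ small → ∀ Q → gain κ Q Q (rK * Q) ≡ rK * Q * ⌜ weightOf κ ⌝
    gain-medium-phase small  κ≢small _ = contradiction refl κ≢small
    gain-medium-phase medium _       Q = begin
      gain medium Q Q (rK * Q)                                          ≡⟨ collect ⌜ wb ⌝ rK c Q t ⟩
      (⌜ wb ⌝ * (rK * Q) + ⌜ wb ⌝ * (rK * Q) + c * (rK * Q)) * (1ℚ - t) ≡⟨ medium-rate (rK * Q) ⟩
      rK * Q * ⌜ mB ⌝                                                   ∎
      where
      open ≡-Reasoning
      collect : ∀ b ρ c Q t → b * ρ * Q * (1ℚ - t) + b * ρ * Q * (1ℚ - t) + c * (ρ * Q) * (1ℚ - t)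
                              ≡ (b * (ρ * Q) + b * (ρ * Q) + c * (ρ * Q)) * (1ℚ - t)
      collect = solve-∀ ℚ-ring
    gain-medium-phase single _ Q = collect ⌜ wb ⌝ rK c Q
      where
      collect : ∀ b ρ c Q → b * ρ * Q * (1ℚ - 1ℚ) + b * ρ * Q * (1ℚ - 1ℚ) + c * (ρ * Q) * (1ℚ - 0ℚ) ≡ ρ * Q * c
      collect = solve-∀ ℚ-ring
    gain-medium-phase big₁ _ Q = gain-big (inj₁ refl) Q (rK * Q)
    gain-medium-phase big₂ _ Q = gain-big (inj₂ refl) Q (rK * Q)

    density-small-phase : ∀ {k e} → k ℕ.≤ KA → e ∉ initial k → density f w (initial k) e ≤ r ^ k
    density-small-phase {k} {e} k≤KA e∉ = density-≤ (initial k) (r ^ k)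
      (subst (_≤ r ^ k * ⌜ w e ⌝) (sym (marginal-small-phase k≤KA e∉))
        (gain-small-phase (kindOf e) (^-antitone r∈ k≤KA)))

    density-small-element : ∀ {k} (k<n : k ℕ.< n) → k ℕ.< KA → density f w (initial k) (fromℕ< k<n) ≡ r ^ k
    density-small-element {k} k<n k<KA = density-≡ (initial k) (r ^ k) (begin
      marginal f (initial k) ⁅ e ⁆       ≡⟨ marginal-small-phase (ℕₚ.<⇒≤ k<KA) (fromℕ<∉initial k<n) ⟩
      gain (kindOf e) 1ℚ 1ℚ (r ^ k)      ≡⟨ subst (λ κ → gain κ 1ℚ 1ℚ (r ^ k) ≡ r ^ k * ⌜ weightOf κ ⌝) (sym e-small)
                                                   (gain-small-phase-small (r ^ k)) ⟩
      r ^ k * ⌜ w e ⌝                    ∎)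
      where
      open ≡-Reasoning
      e = fromℕ< k<n
      e-small : kindOf e ≡ small
      e-small = trans (kindOf-fromℕ< k<n) (kind-small k<KA)

    density-medium-phase : ∀ {k e} → KA ℕ.≤ k → k ℕ.≤ N → e ∈ final k →
                           density f w (initial k) e ≡ rK * t ^ (k ℕ.∸ KA)
    density-medium-phase {k} {e} KA≤k k≤N e∈ =
      subst (λ l → density f w (initial l) e ≡ rK * t ^ j) KA+j≡k
        (density-≡ (initial (KA ℕ.+ j)) (rK * t ^ j)
          (trans (marginal-medium-phase j≤KB (≤⇒∉initial (subst (ℕ._≤ toℕ e) (sym KA+j≡k) (∈final⇒≤ e∈))))
                 (gain-medium-phase (kindOf e) (kind-not-small (ℕₚ.≤-trans KA≤k (∈final⇒≤ e∈)) (Finₚ.toℕ<n e)) (t ^ j))))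
      where
      j = k ℕ.∸ KA
      KA+j≡k : KA ℕ.+ j ≡ k
      KA+j≡k = ℕₚ.m+[n∸m]≡n KA≤k
      j≤KB : j ℕ.≤ KB
      j≤KB = subst (j ℕ.≤_) (ℕₚ.m+n∸m≡n KA KB) (ℕₚ.∸-monoˡ-≤ KA k≤N)

    density-final-phase : ∀ {k e} → m ℕ.≤ k → e ∈ final k → density f w (initial m) e ≡ rK * tK
    density-final-phase {k} {e} m≤k e∈ = density-≡ (initial m) (rK * tK) (begin
      marginal f (initial m) ⁅ e ⁆   ≡⟨ marginal-final-phase (≤⇒∉initial m≤e) ⟩
      gain (kindOf e) tK tK 0ℚ       ≡⟨ gain-big e-big tK 0ℚ ⟩
      rK * tK * ⌜ wb ⌝               ≡⟨ cong (λ x → rK * tK * ⌜ x ⌝) (sym (Big⇒weight e-big)) ⟩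
      rK * tK * ⌜ w e ⌝              ∎)
      where
      open ≡-Reasoning
      m≤e : m ℕ.≤ toℕ e
      m≤e = ℕₚ.≤-trans m≤k (∈final⇒≤ e∈)
      e-big : Big (kindOf e)
      e-big = kind-big m≤e (Finₚ.toℕ<n e)

    greedy-choice : ∀ k (k<n : k ℕ.< n) e → e ∈ final k →
                    density f w (greedyState k) e ≤ density f w (greedyState k) (fromℕ< k<n)
    greedy-choice k k<n e e∈ with m ℕ.≤? k
    ... | yes m≤k rewrite greedyState-≥ m≤k =
      ≤-reflexive (trans (density-final-phase m≤k e∈) (sym (density-final-phase m≤k (fromℕ<∈final k<n))))
    ... | no m≰k rewrite greedyState-≤ (ℕₚ.<⇒≤ (ℕₚ.≰⇒> m≰k)) with k ℕ.<? KA
    ...   | yes k<KA = ≤-trans (density-small-phase {k} (ℕₚ.<⇒≤ k<KA) (≤⇒∉initial (∈final⇒≤ {k = k} e∈)))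
                               (≤-reflexive (sym (density-small-element k<n k<KA)))
    ...   | no k≮KA = ≤-reflexive (trans (density-medium-phase KA≤k k≤N e∈)
                                         (sym (density-medium-phase KA≤k k≤N (fromℕ<∈final k<n))))
      where
      KA≤k = ℕₚ.≮⇒≥ k≮KA
      k≤N = ℕₚ.≤-pred (ℕₚ.≰⇒> m≰k)

    weight-greedy : weight w (initial m) ≡ suc wb ℕ.+ wS
    weight-greedy = begin
      weight w (initial m)                          ≡⟨ weight-initial-suc w N<n ⟩
      weight w (initial N) ℕ.+ w (fromℕ< N<n)       ≡⟨ cong₂ ℕ._+_ weight-small-medium (cong weightOf kindOf-N) ⟩
      suc wb ℕ.+ wS                                 ∎
      where
      open ≡-Reasoning
      weight-small-medium : weight w (initial (KA ℕ.+ KB)) ≡ suc wb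
      weight-small-medium = begin
        weight w (initial (KA ℕ.+ KB))            ≡⟨ weight-initial-block w KA KB N≤n (medium-block weightOf) ⟩
        weight w (initial KA) ℕ.+ KB ℕ.* mB       ≡⟨ cong (ℕ._+ KB ℕ.* mB) (weight-initial-block w 0 KA (ℕₚ.≤-trans KA≤N N≤n) (small-block weightOf)) ⟩
        weight w (initial 0) ℕ.+ KA ℕ.* mA ℕ.+ KB ℕ.* mB ≡⟨ cong (λ S → weight w S ℕ.+ KA ℕ.* mA ℕ.+ KB ℕ.* mB) initial-zero ⟩
        weight w ⊥ ℕ.+ KA ℕ.* mA ℕ.+ KB ℕ.* mB    ≡⟨ cong (λ x → x ℕ.+ KA ℕ.* mA ℕ.+ KB ℕ.* mB) (weight-⊥ w) ⟩
        KA ℕ.* mA ℕ.+ KB ℕ.* mB                   ≡⟨ filler ⟩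
        suc wb                                    ∎

    greedy-fits : ∀ {k} (k<n : k ℕ.< n) → k ℕ.< m → weight w (initial k ∪ ⁅ fromℕ< k<n ⁆) ℕ.≤ W
    greedy-fits {k} k<n k<m = begin
      weight w (initial k ∪ ⁅ fromℕ< k<n ⁆) ≡⟨ cong (weight w) (initial-suc k<n) ⟨
      weight w (initial (suc k))            ≤⟨ weight-mono w (initial-mono k<m) ⟩
      weight w (initial m)                  ≡⟨ weight-greedy ⟩
      suc wb ℕ.+ wS                         ≤⟨ ℕₚ.+-monoˡ-≤ wS (ℕₚ.+-monoˡ-≤ wb (ℕ.>-nonZero⁻¹ wb)) ⟩
      wb ℕ.+ wb ℕ.+ wS                      ∎
      where open ℕₚ.≤-Reasoning

    big-overflows : ∀ {k} (k<n : k ℕ.< n) → m ℕ.≤ k → W ℕ.< weight w (initial m ∪ ⁅ fromℕ< k<n ⁆)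
    big-overflows {k} k<n m≤k = begin-strict
      wb ℕ.+ wb ℕ.+ wS                       <⟨ ℕₚ.n<1+n W ⟩
      suc (wb ℕ.+ wb ℕ.+ wS)                 ≡⟨ ℕ-solve wb wS ⟩
      suc wb ℕ.+ wS ℕ.+ wb                   ≡⟨ cong₂ ℕ._+_ weight-greedy (Big⇒weight e-big) ⟨
      weight w (initial m) ℕ.+ w e           ≡⟨ weight-∪⁅⁆ w (initial m) (≤⇒∉initial m≤e) ⟨
      weight w (initial m ∪ ⁅ e ⁆)           ∎
      where
      open ℕₚ.≤-Reasoning
      e = fromℕ< k<n
      m≤e : m ℕ.≤ toℕ e
      m≤e = subst (m ℕ.≤_) (sym (Finₚ.toℕ-fromℕ< k<n)) m≤k
      e-big : Big (kindOf e)
      e-big = kind-big m≤e (Finₚ.toℕ<n e)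
      ℕ-solve : ∀ b s → suc (b ℕ.+ b ℕ.+ s) ≡ suc b ℕ.+ s ℕ.+ b
      ℕ-solve = ℕ-solve-∀

    greedyState-suc : ∀ k (k<n : k ℕ.< n) → greedyState (suc k) ≡ addIfFits w W (greedyState k) (fromℕ< k<n)
    greedyState-suc k k<n with m ℕ.≤? k
    ... | yes m≤k = begin
      greedyState (suc k)                         ≡⟨ greedyState-≥ (ℕₚ.m≤n⇒m≤1+n m≤k) ⟩
      initial m                                   ≡⟨ addIfFits-overflows w W (initial m) (fromℕ< k<n) (big-overflows k<n m≤k) ⟨
      addIfFits w W (initial m) (fromℕ< k<n)      ≡⟨ cong (λ A → addIfFits w W A (fromℕ< k<n)) (greedyState-≥ m≤k) ⟨
      addIfFits w W (greedyState k) (fromℕ< k<n)  ∎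
      where open ≡-Reasoning
    ... | no m≰k = begin
      greedyState (suc k)                         ≡⟨ greedyState-≤ k<m ⟩
      initial (suc k)                             ≡⟨ initial-suc k<n ⟩
      initial k ∪ ⁅ fromℕ< k<n ⁆                  ≡⟨ addIfFits-fits w W (initial k) (fromℕ< k<n) (greedy-fits k<n k<m) ⟨
      addIfFits w W (initial k) (fromℕ< k<n)      ≡⟨ cong (λ A → addIfFits w W A (fromℕ< k<n)) (greedyState-≤ (ℕₚ.<⇒≤ k<m)) ⟨
      addIfFits w W (greedyState k) (fromℕ< k<n)  ∎
      where
      open ≡-Reasoning
      k<m = ℕₚ.≰⇒> m≰k

    greedy : Greedy f w W (initial m)
    greedy = subst (Greedy f w W) (greedyState-≥ (ℕₚ.m≤n⇒m≤1+n (ℕₚ.n≤1+n m)))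
      (greedy-in-index-order f w W greedyState initial-zero greedyState-suc greedy-choice)

    q₁-prob : ∀ κ → q₁ κ ∈[0,1]
    q₁-prob small  = 0≤1 , ≤-refl
    q₁-prob medium = t∈
    q₁-prob single = 0≤1 , ≤-refl
    q₁-prob big₁   = ≤-refl , 0≤1
    q₁-prob big₂   = 0≤1 , ≤-refl

    q₂-prob : ∀ κ → q₂ κ ∈[0,1]
    q₂-prob small  = 0≤1 , ≤-refl
    q₂-prob medium = t∈
    q₂-prob single = 0≤1 , ≤-refl
    q₂-prob big₁   = 0≤1 , ≤-refl
    q₂-prob big₂   = ≤-refl , 0≤1

    q₃-prob : ∀ κ → q₃ κ ∈[0,1]
    q₃-prob small  = r∈
    q₃-prob medium = t∈
    q₃-prob single = ≤-refl , 0≤1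
    q₃-prob big₁   = 0≤1 , ≤-refl
    q₃-prob big₂   = 0≤1 , ≤-refl

    0≤a : 0ℚ ≤ a
    0≤a = *-nonNeg (⌜⌝-nonNeg wb) 0≤rK

    probabilities₁ : Probabilities (q₁ ∘ kindOf)
    probabilities₁ = q₁-prob ∘ kindOf

    probabilities₂ : Probabilities (q₂ ∘ kindOf)
    probabilities₂ = q₂-prob ∘ kindOf

    probabilities₃ : Probabilities (q₃ ∘ kindOf)
    probabilities₃ = q₃-prob ∘ kindOf

    f-nonNegative : NonNegative f
    f-nonNegative = ⊕-nonNegative {f = cover₁ ⊕ cover₂} {g = cover₃}
      (⊕-nonNegative {f = cover₁} {g = cover₂}
        (coverage-nonNegative 0≤a probabilities₁) (coverage-nonNegative 0≤a probabilities₂))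
      (coverage-nonNegative (⌜⌝-nonNeg wS) probabilities₃)

    f-monotone : Monotone f
    f-monotone = ⊕-monotone {f = cover₁ ⊕ cover₂} {g = cover₃}
      (⊕-monotone {f = cover₁} {g = cover₂}
        (coverage-monotone 0≤a probabilities₁) (coverage-monotone 0≤a probabilities₂))
      (coverage-monotone (⌜⌝-nonNeg wS) probabilities₃)

    f-submodular : Submodular f
    f-submodular = ⊕-submodular {f = cover₁ ⊕ cover₂} {g = cover₃}
      (⊕-submodular {f = cover₁} {g = cover₂}
        (coverage-submodular 0≤a probabilities₁) (coverage-submodular 0≤a probabilities₂))
      (coverage-submodular (⌜⌝-nonNeg wS) probabilities₃)

    f-≤ : ∀ S → f S ≤ a + a + c
    f-≤ S = +-mono-≤ (+-mono-≤ (coverage-≤ 0≤a probabilities₁ S) (coverage-≤ 0≤a probabilities₂ S))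
                     (coverage-≤ (⌜⌝-nonNeg wS) probabilities₃ S)

    w-positive : ∀ e → 0 ℕ.< w e
    w-positive e = ℕ.>-nonZero⁻¹ (w e) {{weightOf-nonZero (kindOf e)}}

    f-⁅⁆ : ∀ e → f ⁅ e ⁆ ≡ value (kindOf e)
    f-⁅⁆ e = cong₂ _+_ (cong₂ _+_ (cong (λ x → a * (1ℚ - x)) (∏-⁅⁆ (q₁ ∘ kindOf) e))
                                  (cong (λ x → a * (1ℚ - x)) (∏-⁅⁆ (q₂ ∘ kindOf) e)))
                       (cong (λ x → c * (1ℚ - x)) (∏-⁅⁆ (q₃ ∘ kindOf) e))

    greedyValue : ℚ
    greedyValue = a * (1ℚ - tK) + a * (1ℚ - tK) + c

    f-greedy : f (initial m) ≡ greedyValue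
    f-greedy = cong₂ _+_ (cong₂ _+_ (cong (λ x → a * (1ℚ - x)) P₁-greedy) (cong (λ x → a * (1ℚ - x)) P₂-greedy))
                         (trans (cong (λ x → c * (1ℚ - x)) P₃-greedy) (*-identityʳ c))

    -- final N consists of the single element and the two big ones.
    f-optimum : f (final N) ≡ a + a + c
    f-optimum = cong₂ _+_ (cong₂ _+_ (covered {a} q₁ m<n (ℕₚ.n≤1+n N) (cong q₁ kind-big₁))
                                     (covered {a} q₂ 1+m<n (ℕₚ.m≤n⇒m≤1+n (ℕₚ.n≤1+n N)) (cong q₂ kind-big₂)))
                          (covered {c} q₃ N<n ℕₚ.≤-refl (cong q₃ kind-single))
      where
      covered : ∀ {v} q {k} (k<n : k ℕ.< n) → N ℕ.≤ k → q (kind k) ≡ 0ℚ → coverage v (q ∘ kindOf) (final N) ≡ v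
      covered {v} q k<n N≤k q≡0 = coverage-covered v (q ∘ kindOf) {i = fromℕ< k<n}
        (≤⇒∈final (subst (N ℕ.≤_) (sym (Finₚ.toℕ-fromℕ< k<n)) N≤k)) (trans (cong q (kindOf-fromℕ< k<n)) q≡0)

    weight-optimum : weight w (final N) ≡ W
    weight-optimum = begin
      weight w (final N)                                                  ≡⟨ weight-final-suc w N<n ⟩
      w (fromℕ< N<n) ℕ.+ weight w (final m)                               ≡⟨ cong (w (fromℕ< N<n) ℕ.+_) (weight-final-suc w m<n) ⟩
      w (fromℕ< N<n) ℕ.+ (w (fromℕ< m<n) ℕ.+ weight w (final (suc m)))    ≡⟨ cong (λ x → w (fromℕ< N<n) ℕ.+ (w (fromℕ< m<n) ℕ.+ x))
                                                                                  (weight-final-suc w 1+m<n) ⟩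
      w (fromℕ< N<n) ℕ.+ (w (fromℕ< m<n) ℕ.+ (w (fromℕ< 1+m<n) ℕ.+ weight w (final n)))
        ≡⟨ cong₂ ℕ._+_ (weight-at N<n kind-single) (cong₂ ℕ._+_ (weight-at m<n kind-big₁)
             (cong₂ ℕ._+_ (weight-at 1+m<n kind-big₂) (weight-final-empty w))) ⟩
      wS ℕ.+ (wb ℕ.+ (wb ℕ.+ 0))                                          ≡⟨ ℕ-solve wb wS ⟩
      W                                                                   ∎
      where
      open ≡-Reasoning
      weight-at : ∀ {k κ} (k<n : k ℕ.< n) → kind k ≡ κ → w (fromℕ< k<n) ≡ weightOf κ
      weight-at k<n kind≡κ = cong weightOf (trans (kindOf-fromℕ< k<n) kind≡κ)
      ℕ-solve : ∀ b s → s ℕ.+ (b ℕ.+ (b ℕ.+ 0)) ≡ b ℕ.+ b ℕ.+ s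
      ℕ-solve = ℕ-solve-∀

    -- Comparisons involving rK and tK, reduced to comparisons between (huge) integers: with
    -- r = rNum / wS and t = tNum / W, rK = x / σ and tK = y / τ.
    module Scaled (rNum tNum : ℕ) (r-scaled : r * ⌜ wS ⌝ ≡ ⌜ rNum ⌝) (t-scaled : t * ⌜ W ⌝ ≡ ⌜ tNum ⌝) where

      σ x τ y : ℚ
      σ = ⌜ wS ℕ.^ KA ⌝
      x = ⌜ rNum ℕ.^ KA ⌝
      τ = ⌜ W ℕ.^ KB ⌝
      y = ⌜ tNum ℕ.^ KB ⌝

      scaledGreedyValue : ℚ → ℚ → ℚ
      scaledGreedyValue x′ y′ = ⌜ wb ⌝ * x′ * (τ - y′) + ⌜ wb ⌝ * x′ * (τ - y′) + c * σ * τ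

      instance
        σ-positive : Positive σ
        σ-positive = ⌜⌝-positive (wS ℕ.^ KA) {{ℕₚ.m^n≢0 wS KA}}

        στ-positive : Positive (σ * τ)
        στ-positive = pos*pos⇒pos σ τ {{⌜⌝-positive (W ℕ.^ KB) {{ℕₚ.m^n≢0 W KB {{W-nonZero}}}}}}

      a*σ : a * σ ≡ ⌜ wb ⌝ * x
      a*σ = trans (*-assoc ⌜ wb ⌝ rK σ) (cong (⌜ wb ⌝ *_) (^-scale KA r-scaled))

      a*στ : a * (σ * τ) ≡ ⌜ wb ⌝ * x * τ
      a*στ = trans (sym (*-assoc a σ τ)) (cong (_* τ) a*σ)

      greedyValue*στ : greedyValue * (σ * τ) ≡ scaledGreedyValue x y
      greedyValue*στ = begin
        greedyValue * (σ * τ)                 ≡⟨ distribute ⌜ wb ⌝ rK tK c σ τ ⟩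
        scaledGreedyValue (rK * σ) (tK * τ)  ≡⟨ cong₂ scaledGreedyValue (^-scale KA r-scaled) (^-scale KB t-scaled) ⟩
        scaledGreedyValue x y                ∎
        where
        open ≡-Reasoning
        distribute : ∀ b ρ θ c σ τ → (b * ρ * (1ℚ - θ) + b * ρ * (1ℚ - θ) + c) * (σ * τ)
                                     ≡ b * (ρ * σ) * (τ - θ * τ) + b * (ρ * σ) * (τ - θ * τ) + c * σ * τ
        distribute = solve-∀ ℚ-ring

      c≤a : True (c * σ ≤? ⌜ wb ⌝ * x) → c ≤ a
      c≤a ok = ≤-by-scaling σ refl a*σ (toWitness ok)

      medium≤a : True ((⌜ wb ⌝ * x + ⌜ wb ⌝ * x + c * σ) * (1ℚ - t) ≤? ⌜ wb ⌝ * x) →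
                 (a + a + c) * (1ℚ - t) ≤ a
      medium≤a ok = ≤-by-scaling σ scaled a*σ (toWitness ok)
        where
        distribute : ∀ a c τ σ → (a + a + c) * τ * σ ≡ (a * σ + a * σ + c * σ) * τ
        distribute = solve-∀ ℚ-ring
        scaled : (a + a + c) * (1ℚ - t) * σ ≡ (⌜ wb ⌝ * x + ⌜ wb ⌝ * x + c * σ) * (1ℚ - t)
        scaled = trans (distribute a c (1ℚ - t) σ) (cong (λ z → (z + z + c * σ) * (1ℚ - t)) a*σ)

      a≤greedy : True (⌜ wb ⌝ * x * τ ≤? scaledGreedyValue x y) → a ≤ greedyValue
      a≤greedy ok = ≤-by-scaling (σ * τ) a*στ greedyValue*στ (toWitness ok)

      greedy<β : True (scaledGreedyValue x y <? β * (⌜ wb ⌝ * x * τ + ⌜ wb ⌝ * x * τ + c * σ * τ)) →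
                 greedyValue < β * (a + a + c)
      greedy<β ok = <-by-scaling (σ * τ) greedyValue*στ scaled (toWitness ok)
        where
        distribute : ∀ β a c σ τ → β * (a + a + c) * (σ * τ) ≡ β * (a * (σ * τ) + a * (σ * τ) + c * σ * τ)
        distribute = solve-∀ ℚ-ring
        scaled : β * (a + a + c) * (σ * τ) ≡ β * (⌜ wb ⌝ * x * τ + ⌜ wb ⌝ * x * τ + c * σ * τ)
        scaled = trans (distribute β a c σ τ) (cong (λ z → β * (z + z + c * σ * τ)) a*στ)

    module Counterexample (c≤a : c ≤ a) (medium≤a : (a + a + c) * (1ℚ - t) ≤ a)
                          (a≤greedy : a ≤ greedyValue) (greedy<β : greedyValue < β * (a + a + c)) where

      value-big₁ : value big₁ ≡ a
      value-big₁ = collect a c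
        where
        collect : ∀ a c → a * (1ℚ - 0ℚ) + a * (1ℚ - 1ℚ) + c * (1ℚ - 1ℚ) ≡ a
        collect = solve-∀ ℚ-ring

      value-≤ : ∀ κ → value κ ≤ a
      value-≤ small  = begin
        value small   ≡⟨ collect a c r ⟩
        c * (1ℚ - r)  ≤⟨ *-monoˡ-≤-nonNeg c {{nonNegative (⌜⌝-nonNeg wS)}} (+-monoʳ-≤ 1ℚ (neg-antimono-≤ (proj₁ r∈))) ⟩
        c * 1ℚ        ≡⟨ *-identityʳ c ⟩
        c             ≤⟨ c≤a ⟩
        a             ∎
        where
        open ≤-Reasoning
        collect : ∀ a c r → a * (1ℚ - 1ℚ) + a * (1ℚ - 1ℚ) + c * (1ℚ - r) ≡ c * (1ℚ - r)
        collect = solve-∀ ℚ-ring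
      value-≤ medium = ≤-trans (≤-reflexive (collect a c t)) medium≤a
        where
        collect : ∀ a c t → a * (1ℚ - t) + a * (1ℚ - t) + c * (1ℚ - t) ≡ (a + a + c) * (1ℚ - t)
        collect = solve-∀ ℚ-ring
      value-≤ single = ≤-trans (≤-reflexive (collect a c)) c≤a
        where
        collect : ∀ a c → a * (1ℚ - 1ℚ) + a * (1ℚ - 1ℚ) + c * (1ℚ - 0ℚ) ≡ c
        collect = solve-∀ ℚ-ring
      value-≤ big₁   = ≤-reflexive value-big₁
      value-≤ big₂   = ≤-reflexive (collect a c)
        where
        collect : ∀ a c → a * (1ℚ - 1ℚ) + a * (1ℚ - 0ℚ) + c * (1ℚ - 1ℚ) ≡ a
        collect = solve-∀ ℚ-ring

      greedy+singleton : GreedySingleton f w W (initial m)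
      greedy+singleton = run (initial m) b₁ greedy b₁-fits singleton-argmax (initial m)
        ((λ _ → refl) , λ greedy<b₁ → ⊥-elim (<-irrefl refl (<-≤-trans greedy<b₁ b₁≤greedy)))
        where
        b₁ : Fin n
        b₁ = fromℕ< m<n
        b₁-big : kindOf b₁ ≡ big₁
        b₁-big = trans (kindOf-fromℕ< m<n) kind-big₁
        b₁-fits : w b₁ ℕ.≤ W
        b₁-fits = subst (ℕ._≤ W) (sym (cong weightOf b₁-big)) (ℕₚ.≤-trans (ℕₚ.m≤m+n wb wb) (ℕₚ.m≤m+n (wb ℕ.+ wb) wS))
        f-b₁ : f ⁅ b₁ ⁆ ≡ a
        f-b₁ = trans (f-⁅⁆ b₁) (trans (cong value b₁-big) value-big₁)
        singleton-argmax : ∀ e → w e ℕ.≤ W → f ⁅ e ⁆ ≤ f ⁅ b₁ ⁆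
        singleton-argmax e _ = subst₂ _≤_ (sym (f-⁅⁆ e)) (sym f-b₁) (value-≤ (kindOf e))
        b₁≤greedy : f ⁅ b₁ ⁆ ≤ f (initial m)
        b₁≤greedy = subst₂ _≤_ (sym f-b₁) (sym f-greedy) a≤greedy

      optimal : Optimal f w W (final N)
      optimal = ℕₚ.≤-reflexive weight-optimum , λ T _ → subst (f T ≤_) (sym f-optimum) (f-≤ T)

      below-β : f (initial m) < β * f (final N)
      below-β = subst₂ (λ x y → x < β * y) (sym f-greedy) (sym f-optimum) greedy<β

      counterexample : NonNegative f × Monotone f × Submodular f × (∀ e → 0 ℕ.< w e) ×
                       Σ (Subset n) λ S → GreedySingleton f w W S ×
                       Σ (Subset n) λ T → Optimal f w W T × (f S < β * f T)
      counterexample = f-nonNegative , f-monotone , f-submodular , w-positive ,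
                       initial m , greedy+singleton , final N , optimal , below-β


module Witness where

  r t : ℚ
  r = + 114631 / 114661
  t = + 1373399 / 1373499

  open Instance 2254 5618 30 100 629419 114661 r t public

  open Calibrated (toWitness {a? = 0ℚ ≤? r} _ , toWitness {a? = r ≤? 1ℚ} _)
                  (toWitness {a? = 0ℚ ≤? t} _ , toWitness {a? = t ≤? 1ℚ} _)
                  refl refl refl

  open Scaled 114631 1373399 refl refl

  open Counterexample (c≤a _) (medium≤a _) (a≤greedy _) (greedy<β _) public

theorem1p2 : Σ ℕ λ n → Σ (SetFn n) λ f → Σ (Fin n → ℕ) λ w → Σ ℕ λ W →
    NonNegative f × Monotone f × Submodular f × (∀ e → 0 ℕ.< w e) ×
    Σ (Subset n) λ S → GreedySingleton f w W S ×
    Σ (Subset n) λ T → Optimal f w W T × (f S < β * f T)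
theorem1p2 = n , f , w , W , counterexample
  where open Witness
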